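{- Let $q\ge 3$ be a prime power, $\mathbb{F}_q$ the field with $q$ elements and $V=\mathbb{F}_q^{\,q+1}$. Then: (1) every simplex point of $V$ is contained in precisely $(q-1)!$ simplex lines; (2) every vertex of the graph $\Gamma$ has degree $(q+1)\bigl[(q-1)!-1\bigr]$.
   Context: A vector of $V=\mathbb{F}_q^{\,q+1}$ is called a simplex vector if precisely one of its coordinates is zero. A point is a $1$-dimensional subspace of $V$ and a line is a $2$-dimensional subspace. A simplex point is a point spanned by a simplex vector; a simplex line is a line all of whose non-zero vectors are simplex vectors (equivalently, a $q$-ary simplex code of dimension $2$ in $V$). $\Gamma$ is the graph whose vertices are all simplex lines, two distinct simplex lines being adjacent if their intersection is $1$-dimensional. -}

module Defs where

open import Level using (Level; _⊔_)
open import Algebra.Bundles using (CommutativeRing)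
open import Data.Nat using (ℕ; suc; _^_; _≤_)
open import Data.Nat.Primality using (Prime)
open import Data.Fin using (Fin)
open import Data.Product using (Σ; ∃; ∃-syntax; _×_; _,_)
open import Data.Unit using (⊤)
open import Data.List using (List; length)
open import Data.List.Relation.Unary.All using (All)
open import Data.List.Relation.Unary.Any using (Any)
open import Data.List.Relation.Unary.AllPairs using (AllPairs)
open import Relation.Nullary using (¬_)
open import Relation.Binary.PropositionalEquality using (_≡_)

-- Generic finite counting up to an equivalence:
-- "the elements a : A with P a, counted up to R, are exactly n in number".
record Count {a p r : Level} (A : Set a) (P : A → Set p) (R : A → A → Set r)
             (n : ℕ) : Set (a ⊔ p ⊔ r) where
  field
    elems    : List A
    len      : length elems ≡ n
    allP     : All P elems
    distinct : AllPairs (λ x y → ¬ R x y) elems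
    complete : ∀ x → P x → Any (R x) elems

record Field (c ℓ : Level) : Set (Level.suc (c ⊔ ℓ)) where
  field
    commRing : CommutativeRing c ℓ
  open CommutativeRing commRing public
  field
    1≉0     : ¬ (1# ≈ 0#)
    inverse : ∀ x → ¬ (x ≈ 0#) → ∃[ y ] (x * y ≈ 1#)

HasSize : ∀ {c ℓ} → Field c ℓ → ℕ → Set (c ⊔ ℓ)
HasSize K q = Count Carrier (λ _ → ⊤) _≈_ q
  where open Field K

IsPrimePower : ℕ → Set
IsPrimePower q = ∃[ p ] ∃[ k ] (Prime p × 1 ≤ k × q ≡ p ^ k)

module Simplex {c ℓ : Level} (K : Field c ℓ) (n : ℕ) where
  open Field K

  V : Set c
  V = Fin n → Carrier

  _≈V_ : V → V → Set ℓ
  u ≈V v = ∀ i → u i ≈ v i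

  0V : V
  0V _ = 0#

  _·_ : Carrier → V → V
  (a · u) i = a * u i

  _⊕_ : V → V → V
  (u ⊕ v) i = u i + v i

  NonZero : V → Set ℓ
  NonZero u = ¬ (u ≈V 0V)

  SimplexVector : V → Set ℓ
  SimplexVector x = ∃[ i ] (x i ≈ 0# × (∀ j → x j ≈ 0# → j ≡ i))

  -- points: spanned by a non-zero vector; membership in ⟨x⟩
  InPoint : V → V → Set (c ⊔ ℓ)
  InPoint x w = ∃[ a ] (w ≈V (a · x))

  -- lines: 2-dimensional subspaces, given by a basis (pair of linearly
  -- independent vectors); a line is the set of vectors it spans.
  Independent : V → V → Set (c ⊔ ℓ)
  Independent u v = ∀ a b → ((a · u) ⊕ (b · v)) ≈V 0V → (a ≈ 0# × b ≈ 0#)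

  Line : Set (c ⊔ ℓ)
  Line = Σ (V × V) (λ { (u , v) → Independent u v })

  InLine : Line → V → Set (c ⊔ ℓ)
  InLine ((u , v) , _) w = ∃[ a ] ∃[ b ] (w ≈V ((a · u) ⊕ (b · v)))

  SameLine : Line → Line → Set (c ⊔ ℓ)
  SameLine L M = (∀ w → InLine L w → InLine M w) × (∀ w → InLine M w → InLine L w)

  SimplexPoint : V → Set ℓ
  SimplexPoint x = SimplexVector x

  SimplexLine : Line → Set (c ⊔ ℓ)
  SimplexLine L = ∀ w → InLine L w → NonZero w → SimplexVector w

  PointInLine : V → Line → Set (c ⊔ ℓ)
  PointInLine x L = ∀ w → InPoint x w → InLine L w

  MeetInPoint : Line → Line → Set (c ⊔ ℓ)
  MeetInPoint L M = ∃[ w ] (NonZero w × InLine L w × InLine M w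
                      × (∀ z → InLine L z → InLine M z → InPoint w z))

  Adjacent : Line → Line → Set (c ⊔ ℓ)
  Adjacent L M = ¬ SameLine L M × MeetInPoint L M

-- Let x be a simplex vector vanishing at i, and label the coordinates ι 0 = i, ι 1, ι (2 + k) for k < q − 1.
-- Every line through ⟨x⟩ is spanned by x and a unique y with y (ι 0) = 1, y (ι 1) = 0 and
-- y (ι (2 + k)) = g k · x (ι (2 + k)). Its vectors outside ⟨x⟩ are multiples of y − s x, which vanishes
-- at ι 1 iff s = 0 and at ι (2 + k) iff g k = s. Hence the line is simplex iff g is a bijection onto the
-- nonzero scalars, and there are (q − 1)! simplex lines through ⟨x⟩.
--
-- A simplex line L = ⟨u, v⟩ contains, for each coordinate k, the simplex point p k = v k · u − u k · v,
-- and every vector of L vanishing at k lies in ⟨p k⟩. So a simplex line M ≠ L meets L in a point iff it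
-- passes through some p k, and it cannot pass through two of them, as two points of L span L. The
-- neighbours of L are therefore the (q − 1)! − 1 simplex lines other than L through each of the q + 1
-- points p k.

module Submission where

open import Defs
open import Level using (Level; _⊔_)
open import Algebra.Bundles using (CommutativeRing)
open import Algebra.Solver.Ring.AlmostCommutativeRing using (fromCommutativeRing; _-Raw-AlmostCommutative⟶_)
open import Data.Nat as ℕ using (ℕ; zero; suc; _≤_; _∸_; _!; s≤s)
import Data.Nat.Properties as ℕₚ
open import Data.Integer as ℤ using (ℤ; +_; -[1+_]; _⊖_)
import Data.Integer.Properties as ℤₚ
open import Data.Sign as Sign using (Sign)
open import Data.Maybe using (Maybe; just; nothing)
open import Data.Fin using (Fin; zero; suc)
import Data.Fin.Properties as Fin
open import Data.Fin.Permutation using (Permutation′; transpose; _⟨$⟩ʳ_; _⟨$⟩ˡ_; inverseˡ; inverseʳ)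
open import Data.Product using (∃-syntax; _×_; _,_; proj₁; proj₂; swap)
open import Data.Sum using (_⊎_; inj₁; inj₂)
open import Data.Unit using (⊤; tt)
open import Data.Empty using (⊥; ⊥-elim)
open import Data.List using (List; []; _∷_; length; map; _++_; allFin)
open import Data.List.Properties using (length-map; length-++; length-removeAt; length-tabulate)
open import Data.List.Relation.Unary.All as All using (All; []; _∷_)
open import Data.List.Relation.Unary.Any as Any using (Any; here; there; _─_)
open import Data.List.Relation.Unary.AllPairs as AllPairs using (AllPairs; []; _∷_)
import Data.List.Relation.Unary.All.Properties as All
import Data.List.Relation.Unary.Any.Properties as Any
import Data.List.Relation.Unary.AllPairs.Properties as AllPairs
open import Data.List.Relation.Unary.Unique.Propositional.Properties using (allFin⁺)
open import Data.List.Membership.Propositional.Properties using (∈-allFin)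
open import Data.Vec.Functional using () renaming (_∷_ to _◂_)
open import Data.Vec.Functional.Relation.Binary.Pointwise using (Pointwise)
import Data.Vec.Functional.Relation.Binary.Pointwise.Properties as Pointwise
open import Relation.Nullary using (¬_; Dec; yes; no)
open import Relation.Binary using (Setoid; _Respects_)
import Relation.Binary.PropositionalEquality as ≡
open ≡ using (_≡_)

module Counting where

  private variable
    a b p q ℓ₁ ℓ₂ : Level
    m n : ℕ

  module _ {A : Set a} {P : A → Set p} where

    AllPairs-─⁺ : ∀ {S : A → A → Set ℓ₂} {xs} (i : Any P xs) → AllPairs S xs → AllPairs S (xs ─ i)
    AllPairs-─⁺ (here _)  (_ ∷ ss)  = ss
    AllPairs-─⁺ (there i) (sx ∷ ss) = All.─⁺ i sx ∷ AllPairs-─⁺ i ss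

    AllPairs-lookup-─ : ∀ {S : A → A → Set ℓ₂} → (∀ {x y} → S x y → S y x) →
                        ∀ {xs} (i : Any P xs) → AllPairs S xs → All (S (Any.lookup i)) (xs ─ i)
    AllPairs-lookup-─ sym (here _)  (sx ∷ _)  = sx
    AllPairs-lookup-─ sym (there i) (sx ∷ ss) =
      sym (proj₁ (All.lookupAny sx i)) ∷ AllPairs-lookup-─ sym i ss

    Any-─ : ∀ {Q : A → Set q} {xs} (i : Any P xs) → Any Q xs →
            (∃[ x ] (P x × Q x)) ⊎ Any Q (xs ─ i)
    Any-─ (here px) (here qx) = inj₁ (_ , px , qx)
    Any-─ (here _)  (there j) = inj₂ j
    Any-─ (there _) (here qx) = inj₂ (here qx)
    Any-─ (there i) (there j) with Any-─ i j
    ... | inj₁ hit = inj₁ hit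
    ... | inj₂ j′  = inj₂ (there j′)

  module _ (S : Setoid a ℓ₁) where
    open Setoid S renaming (Carrier to A)

    count-cong : ∀ {P : A → Set p} {Q : A → Set q} → (∀ {x} → P x → Q x) → (∀ {x} → Q x → P x) →
                 Count A P _≈_ n → Count A Q _≈_ n
    count-cong P⇒Q Q⇒P c = record
      { elems = elems ; len = len ; allP = All.map P⇒Q allP ; distinct = distinct
      ; complete = λ x qx → complete x (Q⇒P qx) }
      where open Count c

    count⇒decidable : ∀ {P : A → Set p} → Count A P _≈_ n → ∀ {x y} → P x → P y → Dec (x ≈ y)
    count⇒decidable c px py = go distinct (complete _ px) (complete _ py)
      where
      open Count c
      go : ∀ {xs x y} → AllPairs (λ u v → ¬ u ≈ v) xs → Any (x ≈_) xs → Any (y ≈_) xs → Dec (x ≈ y)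
      go _ (here x≈) (here y≈) = yes (trans x≈ (sym y≈))
      go (d ∷ _) (here x≈) (there j) =
        no λ x≈y → All.lookupWith (λ u≉ y≈ → u≉ (trans (sym x≈) (trans x≈y y≈))) d j
      go (d ∷ _) (there i) (here y≈) =
        no λ x≈y → All.lookupWith (λ u≉ x≈ → u≉ (trans (sym y≈) (trans (sym x≈y) x≈))) d i
      go (_ ∷ ds) (there i) (there j) = go ds i j

    count-remove : ∀ {P : A → Set p} {n} → Count A P _≈_ n → ∀ {a} → P a →
                   Count A (λ x → P x × ¬ a ≈ x) _≈_ (n ∸ 1)
    count-remove {n = n} c {a} pa = record
      { elems = elems ─ a∈
      ; len = ≡.trans (length-removeAt elems (Any.index a∈))
                      (≡.trans (≡.cong ℕ.pred len) (ℕₚ.pred[m∸n]≡m∸[1+n] n 0))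
      ; allP = All.zipWith (λ (px , a≉) → px , λ a≈ → a≉ (trans (sym a≈-at) a≈))
                 (All.─⁺ a∈ allP , AllPairs-lookup-─ (λ ne e → ne (sym e)) a∈ distinct)
      ; distinct = AllPairs-─⁺ a∈ distinct
      ; complete = λ x (px , a≉x) → case (Any-─ a∈ (complete x px)) a≉x
      }
      where
      open Count c
      a∈ = complete a pa
      a≈-at = Any.lookup-result a∈
      case : ∀ {x} → (∃[ y ] (a ≈ y × x ≈ y)) ⊎ Any (x ≈_) (elems ─ a∈) → ¬ a ≈ x →
             Any (x ≈_) (elems ─ a∈)
      case (inj₁ (_ , a≈y , x≈y)) a≉x = ⊥-elim (a≉x (trans a≈y (sym x≈y)))
      case (inj₂ x∈) _ = x∈

  count-allFin : ∀ n → Count (Fin n) (λ _ → ⊤) _≡_ n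
  count-allFin n = record
    { elems = allFin n ; len = length-tabulate (λ i → i) ; allP = All.universal (λ _ → tt) _
    ; distinct = allFin⁺ n ; complete = λ i _ → ∈-allFin i }

  module _ (S : Setoid a ℓ₁) (T : Setoid b ℓ₂) where
    open Setoid S renaming (Carrier to A; _≈_ to _≈₁_)
    open Setoid T renaming (Carrier to B; _≈_ to _≈₂_; sym to sym₂; trans to trans₂)

    count-map : ∀ {P : A → Set p} {Q : B → Set q} (f : A → B) →
                (∀ {x y} → x ≈₁ y → f x ≈₂ f y) → (∀ {x y} → f x ≈₂ f y → x ≈₁ y) →
                (∀ {x} → P x → Q (f x)) → (∀ {y} → Q y → ∃[ x ] (P x × y ≈₂ f x)) →
                Count A P _≈₁_ n → Count B Q _≈₂_ n
    count-map f f-cong f-injective P⇒Q Q⇒P c = record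
      { elems = map f elems
      ; len = ≡.trans (length-map f elems) len
      ; allP = All.map⁺ (All.map P⇒Q allP)
      ; distinct = AllPairs.map⁺ (AllPairs.map (λ x≉y fx≈fy → x≉y (f-injective fx≈fy)) distinct)
      ; complete = λ y qy → let (x , px , y≈fx) = Q⇒P qy in
          Any.map⁺ (Any.map (λ x≈ → trans₂ y≈fx (f-cong x≈)) (complete x px))
      }
      where open Count c

    module _ {P : A → Set p} {Q : A → B → Set q}
             (count-fibre : ∀ {x} → P x → Count B (Q x) _≈₂_ m)
             (Q-resp : ∀ {x x′ y} → x ≈₁ x′ → Q x y → Q x′ y)
             (Q-disjoint : ∀ {x x′ y y′} → ¬ x ≈₁ x′ → Q x y → Q x′ y′ → ¬ y ≈₂ y′) where

      private
        fibres : (xs : List A) → All P xs → List B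
        fibres []       []        = []
        fibres (x ∷ xs) (px ∷ ps) = Count.elems (count-fibre px) ++ fibres xs ps

        length-fibres : ∀ xs ps → length (fibres xs ps) ≡ length xs ℕ.* m
        length-fibres []       []        = ≡.refl
        length-fibres (x ∷ xs) (px ∷ ps) =
          ≡.trans (length-++ (Count.elems (count-fibre px)))
                  (≡.cong₂ ℕ._+_ (Count.len (count-fibre px)) (length-fibres xs ps))

        fibres-over : ∀ xs ps → All (λ y → Any (λ x → Q x y) xs) (fibres xs ps)
        fibres-over []       []        = []
        fibres-over (x ∷ xs) (px ∷ ps) =
          All.++⁺ (All.map here (Count.allP (count-fibre px))) (All.map there (fibres-over xs ps))

        fibres-distinct : ∀ xs ps → AllPairs (λ x y → ¬ x ≈₁ y) xs →
                          AllPairs (λ y y′ → ¬ y ≈₂ y′) (fibres xs ps)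
        fibres-distinct []       []        []        = []
        fibres-distinct (x ∷ xs) (px ∷ ps) (x≉ ∷ ds) =
          AllPairs.++⁺ (Count.distinct (count-fibre px)) (fibres-distinct xs ps ds)
            (All.map (λ qy → All.map (All.lookupWith (λ x≉x′ qy′ → Q-disjoint x≉x′ qy qy′) x≉)
                                     (fibres-over xs ps))
                     (Count.allP (count-fibre px)))

        fibres-complete : ∀ {y} xs ps → Any (λ x → Q x y) xs → Any (y ≈₂_) (fibres xs ps)
        fibres-complete (x ∷ xs) (px ∷ ps) (here qy)  = Any.++⁺ˡ (Count.complete (count-fibre px) _ qy)
        fibres-complete (x ∷ xs) (px ∷ ps) (there y∈) =
          Any.++⁺ʳ (Count.elems (count-fibre px)) (fibres-complete xs ps y∈)

      count-Σ : Count A P _≈₁_ n → Count B (λ y → ∃[ x ] (P x × Q x y)) _≈₂_ (n ℕ.* m)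
      count-Σ c = record
        { elems = fibres elems allP
        ; len = ≡.trans (length-fibres elems allP) (≡.cong (ℕ._* m) len)
        ; allP = All.map (λ y-over → All.lookupWith (λ px qy → _ , px , qy) allP y-over) (fibres-over elems allP)
        ; distinct = fibres-distinct elems allP distinct
        ; complete = λ y (x , px , qy) →
            fibres-complete elems allP (Any.map (λ x≈ → Q-resp x≈ qy) (complete x px))
        }
        where open Count c

  module _ (S : Setoid a ℓ₁) where
    open Setoid S renaming (Carrier to A)

    record Enumerates (P : A → Set p) {k} (g : Fin k → A) : Set (a ⊔ p ⊔ ℓ₁) where
      field
        into      : ∀ j → P (g j)
        injective : ∀ {j j′} → g j ≈ g j′ → j ≡ j′
        onto      : ∀ {x} → P x → ∃[ j ] (g j ≈ x)

    private
      _∖_ : (A → Set p) → A → A → Set _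
      (P ∖ x) y = P y × ¬ x ≈ y

      ∖-resp : ∀ {P : A → Set p} {x} → P Respects _≈_ → (P ∖ x) Respects _≈_
      ∖-resp resp y≈z (py , x≉y) = resp y≈z py , λ x≈z → x≉y (trans x≈z (sym y≈z))

      enumerates-cong : ∀ {P Q : A → Set p} {k} {g : Fin k → A} →
                        (∀ {x} → P x → Q x) → (∀ {x} → Q x → P x) → Enumerates P g → Enumerates Q g
      enumerates-cong P⇒Q Q⇒P e = record
        { into = λ j → P⇒Q (into j) ; injective = injective ; onto = λ qx → onto (Q⇒P qx) }
        where open Enumerates e

      Cons : (A → Set p) → ∀ {k} → A → (Fin (suc k) → A) → Set _
      Cons P x g = g zero ≈ x × Enumerates (P ∖ x) (λ j → g (suc j))

      uncons : ∀ {P : A → Set p} {k} {g : Fin (suc k) → A} → Enumerates P g → ∃[ x ] (P x × Cons P x g)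
      uncons {g = g} e = g zero , into zero , refl , record
        { into = λ j → into (suc j) , λ g0≈ → Fin.0≢1+n (injective g0≈)
        ; injective = λ gj≈ → Fin.suc-injective (injective gj≈)
        ; onto = λ (px , g0≉x) → tail (onto px) g0≉x
        }
        where
        open Enumerates e
        tail : ∀ {x} → ∃[ j ] (g j ≈ x) → ¬ g zero ≈ x → ∃[ j ] (g (suc j) ≈ x)
        tail (zero , g0≈x)  g0≉x = ⊥-elim (g0≉x g0≈x)
        tail (suc j , gj≈x) _    = j , gj≈x

      cons : ∀ {P : A → Set p} {k} {g : Fin (suc k) → A} → P Respects _≈_ →
             ∀ {x} → P x → (∀ {y} → P y → Dec (x ≈ y)) → Cons P x g → Enumerates P g
      cons {P = P} {g = g} resp {x} px x≟ (g0≈x , e) = record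
        { into = λ { zero → resp (sym g0≈x) px ; (suc j) → proj₁ (into j) }
        ; injective = inj
        ; onto = head-or-tail
        }
        where
        open Enumerates e
        inj : ∀ {j j′} → g j ≈ g j′ → j ≡ j′
        inj {zero}  {zero}   _  = ≡.refl
        inj {zero}  {suc j′} g≈ = ⊥-elim (proj₂ (into j′) (trans (sym g0≈x) g≈))
        inj {suc j} {zero}   g≈ = ⊥-elim (proj₂ (into j) (trans (sym g0≈x) (sym g≈)))
        inj {suc j} {suc j′} g≈ = ≡.cong suc (injective g≈)
        head-or-tail : ∀ {y} → P y → ∃[ j ] (g j ≈ y)
        head-or-tail py with x≟ py
        ... | yes x≈y = zero , trans g0≈x x≈y
        ... | no x≉y  = let (j , gj≈y) = onto (py , x≉y) in suc j , gj≈y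

    -- An enumeration of P by Fin (suc k) is a value x ∈ P followed by an enumeration of P ∖ x,
    -- so the enumerations are counted fibrewise over their first value.
    count-enumerations : ∀ {P : A → Set p} {k} → P Respects _≈_ →
                         Count A P _≈_ k → Count (Fin k → A) (Enumerates P) (Pointwise _≈_) (k !)
    count-enumerations {k = zero} _ c = record
      { elems = (λ ()) ∷ []
      ; len = ≡.refl
      ; allP = record { into = λ () ; injective = λ { {()} } ; onto = λ px → ⊥-elim (empty len (complete _ px)) }
             ∷ []
      ; distinct = [] ∷ []
      ; complete = λ _ _ → here λ ()
      }
      where
      open Count c
      empty : ∀ {Q : A → Set ℓ₁} {xs} → length xs ≡ 0 → Any Q xs → ⊥
      empty {xs = []} _ ()
    count-enumerations {P = P} {k = suc k} resp c =
      count-cong Fᵏ⁺¹ (λ (_ , px , cx) → cons resp px (count⇒decidable S c px) cx) uncons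
        (count-Σ S Fᵏ⁺¹ count-cons (λ {x} {x′} {g} → Cons-resp {x} {x′} {g}) Cons-disjoint c)
      where
      Fᵏ = Pointwise.setoid S k
      Fᵏ⁺¹ = Pointwise.setoid S (suc k)

      count-cons : ∀ {x} → P x → Count (Fin (suc k) → A) (Cons P x) (Pointwise _≈_) (k !)
      count-cons px = count-map Fᵏ Fᵏ⁺¹ (_ ◂_)
        (λ g≈ → λ { zero → refl ; (suc j) → g≈ j }) (λ g≈ j → g≈ (suc j))
        (refl ,_) (λ (g0≈ , e) → _ , e , λ { zero → g0≈ ; (suc j) → refl })
        (count-enumerations (∖-resp resp) (count-remove S c px))

      Cons-resp : ∀ {x x′ g} → x ≈ x′ → Cons P x g → Cons P x′ g
      Cons-resp x≈x′ (g0≈x , e) = trans g0≈x x≈x′ , enumerates-cong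
        (λ (py , x≉y) → py , λ x′≈y → x≉y (trans x≈x′ x′≈y))
        (λ (py , x′≉y) → py , λ x≈y → x′≉y (trans (sym x≈x′) x≈y)) e

      Cons-disjoint : ∀ {x x′ g g′} → ¬ x ≈ x′ → Cons P x g → Cons P x′ g′ → ¬ Pointwise _≈_ g g′
      Cons-disjoint x≉x′ (g0≈x , _) (g′0≈x′ , _) g≈g′ =
        x≉x′ (trans (sym g0≈x) (trans (g≈g′ zero) g′0≈x′))

open Counting

-- The standard library's ring solver needs coefficients with decidable equality;
-- the integers map homomorphically into every commutative ring.
module IntegerCoefficients {c ℓ : Level} (R : CommutativeRing c ℓ) where
  open CommutativeRing R
  open import Algebra.Properties.Ring ring
  open import Algebra.Properties.Semiring.Mult semiring renaming (_×_ to _·ℕ_)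
  open import Relation.Binary.Reasoning.Setoid setoid

  fromℕ : ℕ → Carrier
  fromℕ n = n ·ℕ 1#

  fromℤ : ℤ → Carrier
  fromℤ (+ n)    = fromℕ n
  fromℤ -[1+ n ] = - fromℕ (suc n)

  signed : Sign → Carrier → Carrier
  signed Sign.+ x = x
  signed Sign.- x = - x

  signed-cong : ∀ s {x y} → x ≈ y → signed s x ≈ signed s y
  signed-cong Sign.+ = λ x≈y → x≈y
  signed-cong Sign.- = -‿cong

  signed-* : ∀ s t x y → signed (s Sign.* t) (x * y) ≈ signed s x * signed t y
  signed-* Sign.+ Sign.+ x y = refl
  signed-* Sign.+ Sign.- x y = -‿distribʳ-* x y
  signed-* Sign.- Sign.+ x y = -‿distribˡ-* x y
  signed-* Sign.- Sign.- x y = begin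
    x * y         ≈⟨ -‿involutive (x * y) ⟨
    - - (x * y)   ≈⟨ -‿cong (-‿distribʳ-* x y) ⟩
    - (x * - y)   ≈⟨ -‿distribˡ-* x (- y) ⟩
    - x * - y     ∎

  fromℤ-◃ : ∀ s n → fromℤ (s ℤ.◃ n) ≈ signed s (fromℕ n)
  fromℤ-◃ Sign.+ zero    = refl
  fromℤ-◃ Sign.+ (suc n) = refl
  fromℤ-◃ Sign.- zero    = sym -0#≈0#
  fromℤ-◃ Sign.- (suc n) = refl

  fromℤ-sign-abs : ∀ i → fromℤ i ≈ signed (ℤ.sign i) (fromℕ ℤ.∣ i ∣)
  fromℤ-sign-abs (+ n)    = refl
  fromℤ-sign-abs -[1+ n ] = refl

  [1+x]-[1+y]≈x-y : ∀ x y → (1# + x) - (1# + y) ≈ x - y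
  [1+x]-[1+y]≈x-y x y = begin
    (1# + x) - (1# + y)       ≈⟨ +-cong (+-comm x 1#) (-‿+-comm 1# y) ⟨
    (x + 1#) + (- 1# + - y)   ≈⟨ +-assoc x 1# _ ⟩
    x + (1# + (- 1# + - y))   ≈⟨ +-congˡ (+-assoc 1# (- 1#) _) ⟨
    x + ((1# + - 1#) + - y)   ≈⟨ +-congˡ (+-congʳ (-‿inverseʳ 1#)) ⟩
    x + (0# + - y)            ≈⟨ +-congˡ (+-identityˡ _) ⟩
    x - y                     ∎

  fromℤ-⊖ : ∀ m n → fromℤ (m ⊖ n) ≈ fromℕ m - fromℕ n
  fromℤ-⊖ m       zero    = sym (trans (+-congˡ -0#≈0#) (+-identityʳ _))
  fromℤ-⊖ zero    (suc n) = sym (+-identityˡ _)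
  fromℤ-⊖ (suc m) (suc n) = begin
    fromℤ (suc m ⊖ suc n)          ≡⟨ ≡.cong fromℤ (ℤₚ.[1+m]⊖[1+n]≡m⊖n m n) ⟩
    fromℤ (m ⊖ n)                  ≈⟨ fromℤ-⊖ m n ⟩
    fromℕ m - fromℕ n              ≈⟨ [1+x]-[1+y]≈x-y _ _ ⟨
    fromℕ (suc m) - fromℕ (suc n)  ∎

  fromℤ-+ : ∀ i j → fromℤ (i ℤ.+ j) ≈ fromℤ i + fromℤ j
  fromℤ-+ (+ m)    (+ n)    = ×-homo-+ 1# m n
  fromℤ-+ (+ m)    -[1+ n ] = fromℤ-⊖ m (suc n)
  fromℤ-+ -[1+ m ] (+ n)    = trans (fromℤ-⊖ n (suc m)) (+-comm _ _)
  fromℤ-+ -[1+ m ] -[1+ n ] = begin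
    - fromℕ (suc (suc (m ℕ.+ n)))    ≡⟨ ≡.cong (λ k → - fromℕ (suc k)) (ℕₚ.+-suc m n) ⟨
    - fromℕ (suc m ℕ.+ suc n)        ≈⟨ -‿cong (×-homo-+ 1# (suc m) (suc n)) ⟩
    - (fromℕ (suc m) + fromℕ (suc n)) ≈⟨ -‿+-comm _ _ ⟨
    - fromℕ (suc m) + - fromℕ (suc n) ∎

  fromℤ-* : ∀ i j → fromℤ (i ℤ.* j) ≈ fromℤ i * fromℤ j
  fromℤ-* i j = begin
    fromℤ (s ℤ.◃ (∣i∣ ℕ.* ∣j∣))                          ≈⟨ fromℤ-◃ s (∣i∣ ℕ.* ∣j∣) ⟩
    signed s (fromℕ (∣i∣ ℕ.* ∣j∣))                        ≈⟨ signed-cong s (×1-homo-* ∣i∣ ∣j∣) ⟩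
    signed s (fromℕ ∣i∣ * fromℕ ∣j∣)                      ≈⟨ signed-* (ℤ.sign i) (ℤ.sign j) _ _ ⟩
    signed (ℤ.sign i) (fromℕ ∣i∣) * signed (ℤ.sign j) (fromℕ ∣j∣)
                                                         ≈⟨ *-cong (fromℤ-sign-abs i) (fromℤ-sign-abs j) ⟨
    fromℤ i * fromℤ j                                    ∎
    where
    s = ℤ.sign i Sign.* ℤ.sign j
    ∣i∣ = ℤ.∣ i ∣
    ∣j∣ = ℤ.∣ j ∣

  fromℤ-- : ∀ i → fromℤ (ℤ.- i) ≈ - fromℤ i
  fromℤ-- (+ zero)  = sym -0#≈0#
  fromℤ-- (+ suc n) = refl
  fromℤ-- -[1+ n ]  = sym (-‿involutive _)

  fromℤ-homomorphism : ℤ.+-*-rawRing -Raw-AlmostCommutative⟶ fromCommutativeRing R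
  fromℤ-homomorphism = record
    { ⟦_⟧ = fromℤ ; +-homo = fromℤ-+ ; *-homo = fromℤ-* ; -‿homo = fromℤ--
    ; 0-homo = refl ; 1-homo = +-identityʳ 1# }

  fromℤ-≟ : ∀ i j → Maybe (fromℤ i ≈ fromℤ j)
  fromℤ-≟ i j with i ℤ.≟ j
  ... | yes ≡.refl = just refl
  ... | no _       = nothing

  open import Algebra.Solver.Ring ℤ.+-*-rawRing (fromCommutativeRing R) fromℤ-homomorphism fromℤ-≟ public

module FieldProperties {c ℓ : Level} (K : Field c ℓ) where
  open Field K
  open IntegerCoefficients commRing public using (solve; _:=_; _:+_; _:*_; :-_; _:-_; con)
  open import Algebra.Properties.Ring ring public using (-0#≈0#)
  open import Algebra.Properties.Ring ring using (-‿involutive)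
  open import Relation.Binary.Reasoning.Setoid setoid

  inv : ∀ x → ¬ x ≈ 0# → Carrier
  inv x x≉0 = proj₁ (inverse x x≉0)

  inv-*ʳ : ∀ x (x≉0 : ¬ x ≈ 0#) → x * inv x x≉0 ≈ 1#
  inv-*ʳ x x≉0 = proj₂ (inverse x x≉0)

  inv-*ˡ : ∀ x (x≉0 : ¬ x ≈ 0#) → inv x x≉0 * x ≈ 1#
  inv-*ˡ x x≉0 = trans (*-comm _ x) (inv-*ʳ x x≉0)

  *≈0⇒≈0ʳ : ∀ {x y} → ¬ x ≈ 0# → x * y ≈ 0# → y ≈ 0#
  *≈0⇒≈0ʳ {x} {y} x≉0 xy≈0 = begin
    y                    ≈⟨ *-identityˡ y ⟨
    1# * y               ≈⟨ *-congʳ (inv-*ˡ x x≉0) ⟨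
    inv x x≉0 * x * y    ≈⟨ *-assoc _ x y ⟩
    inv x x≉0 * (x * y)  ≈⟨ *-congˡ xy≈0 ⟩
    inv x x≉0 * 0#       ≈⟨ zeroʳ _ ⟩
    0#                   ∎

  *≈0⇒≈0ˡ : ∀ {x y} → ¬ y ≈ 0# → x * y ≈ 0# → x ≈ 0#
  *≈0⇒≈0ˡ {x} {y} y≉0 xy≈0 = *≈0⇒≈0ʳ y≉0 (trans (*-comm y x) xy≈0)

  -≈0⇒≈0 : ∀ {x} → - x ≈ 0# → x ≈ 0#
  -≈0⇒≈0 {x} -x≈0 = trans (sym (-‿involutive x)) (trans (-‿cong -x≈0) -0#≈0#)

  x-y≈0⇒x≈y : ∀ {x y} → x - y ≈ 0# → x ≈ y
  x-y≈0⇒x≈y {x} {y} x-y≈0 = begin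
    x              ≈⟨ solve 2 (λ x y → x := x :- y :+ y) refl x y ⟩
    x - y + y      ≈⟨ +-congʳ x-y≈0 ⟩
    0# + y         ≈⟨ +-identityˡ y ⟩
    y              ∎

  *-cancelʳ : ∀ {x y z} → ¬ z ≈ 0# → x * z ≈ y * z → x ≈ y
  *-cancelʳ {x} {y} {z} z≉0 xz≈yz = x-y≈0⇒x≈y (*≈0⇒≈0ˡ z≉0 (begin
    (x - y) * z     ≈⟨ solve 3 (λ x y z → (x :- y) :* z := x :* z :- y :* z) refl x y z ⟩
    x * z - y * z   ≈⟨ +-congʳ xz≈yz ⟩
    y * z - y * z   ≈⟨ -‿inverseʳ (y * z) ⟩
    0#              ∎))

module Vectors {c ℓ : Level} (K : Field c ℓ) (n : ℕ) where
  open Field K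
  open FieldProperties K
  open Simplex K n
  open import Relation.Binary.Reasoning.Setoid setoid

  Span : V → V → V → Set (c ⊔ ℓ)
  Span u v w = ∃[ a ] ∃[ b ] (w ≈V ((a · u) ⊕ (b · v)))

  span-resp : ∀ {u v w w′} → w ≈V w′ → Span u v w → Span u v w′
  span-resp w≈w′ (a , b , w≈) = a , b , λ t → trans (sym (w≈w′ t)) (w≈ t)

  span-lincomb : ∀ {u v w₁ w₂} → Span u v w₁ → Span u v w₂ →
                 ∀ α β → Span u v ((α · w₁) ⊕ (β · w₂))
  span-lincomb {u} {v} {w₁} {w₂} (a₁ , b₁ , w₁≈) (a₂ , b₂ , w₂≈) α β =
    α * a₁ + β * a₂ , α * b₁ + β * b₂ , λ t → begin
      α * w₁ t + β * w₂ t                         ≈⟨ +-cong (*-congˡ (w₁≈ t)) (*-congˡ (w₂≈ t)) ⟩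
      α * (a₁ * u t + b₁ * v t) + β * (a₂ * u t + b₂ * v t)
        ≈⟨ solve 8 (λ α β a₁ b₁ a₂ b₂ u v → α :* (a₁ :* u :+ b₁ :* v) :+ β :* (a₂ :* u :+ b₂ :* v)
                      := (α :* a₁ :+ β :* a₂) :* u :+ (α :* b₁ :+ β :* b₂) :* v)
                   refl α β a₁ b₁ a₂ b₂ (u t) (v t) ⟩
      (α * a₁ + β * a₂) * u t + (α * b₁ + β * b₂) * v t ∎

  span-scale : ∀ {u v w} → Span u v w → ∀ α → Span u v (α · w)
  span-scale {u} {v} {w} (a , b , w≈) α = α * a , α * b , λ t → begin
    α * w t                     ≈⟨ *-congˡ (w≈ t) ⟩
    α * (a * u t + b * v t)
      ≈⟨ solve 5 (λ α a b u v → α :* (a :* u :+ b :* v) := α :* a :* u :+ α :* b :* v) refl α a b (u t) (v t) ⟩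
    α * a * u t + α * b * v t   ∎

  span-left : ∀ {u v} → Span u v u
  span-left {u} {v} = 1# , 0# , λ t → sym (trans (+-cong (*-identityˡ (u t)) (zeroˡ (v t))) (+-identityʳ (u t)))

  span-right : ∀ {u v} → Span u v v
  span-right {u} {v} = 0# , 1# , λ t → sym (trans (+-cong (zeroˡ (u t)) (*-identityˡ (v t))) (+-identityˡ (v t)))

  -- Cramer's rule: independence of x = αu + βv and y = γu + δv makes αδ − βγ invertible.
  span-⊆ : ∀ {x y u v} → Independent x y → Span u v x → Span u v y → ∀ {w} → Span u v w → Span x y w
  span-⊆ {x} {y} {u} {v} x,y-indep (α , β , x≈) (γ , δ , y≈) {w} (a , b , w≈) =
    a * (D⁻¹ * δ) + b * (D⁻¹ * - γ) , a * (D⁻¹ * - β) + b * (D⁻¹ * α) , λ t → begin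
      w t                                   ≈⟨ w≈ t ⟩
      a * u t + b * v t                     ≈⟨ +-cong (*-congʳ (*-identityʳ a)) (*-congʳ (*-identityʳ b)) ⟨
      a * 1# * u t + b * 1# * v t           ≈⟨ +-cong (*-congʳ (*-congˡ D⁻¹D≈1)) (*-congʳ (*-congˡ D⁻¹D≈1)) ⟨
      a * (D⁻¹ * D) * u t + b * (D⁻¹ * D) * v t
        ≈⟨ solve 9 (λ a b E α β γ δ u v →
               a :* (E :* (α :* δ :- β :* γ)) :* u :+ b :* (E :* (α :* δ :- β :* γ)) :* v
            := (a :* (E :* δ) :+ b :* (E :* (:- γ))) :* (α :* u :+ β :* v)
                 :+ (a :* (E :* (:- β)) :+ b :* (E :* α)) :* (γ :* u :+ δ :* v))
             refl a b D⁻¹ α β γ δ (u t) (v t) ⟩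
      _ * (α * u t + β * v t) + _ * (γ * u t + δ * v t)
                                            ≈⟨ +-cong (*-congˡ (x≈ t)) (*-congˡ (y≈ t)) ⟨
      _ * x t + _ * y t                     ∎
    where
    D = α * δ - β * γ

    D≉0 : ¬ D ≈ 0#
    D≉0 D≈0 = 1≉0 (proj₁ (x,y-indep 1# 0# x≈0))
      where
      D*≈0 : ∀ {z} → D * z ≈ 0#
      D*≈0 {z} = trans (*-congʳ D≈0) (zeroˡ z)
      α≈0 : α ≈ 0#
      α≈0 = proj₂ (x,y-indep (- γ) α λ t → begin
        - γ * x t + α * y t                                 ≈⟨ +-cong (*-congˡ (x≈ t)) (*-congˡ (y≈ t)) ⟩
        - γ * (α * u t + β * v t) + α * (γ * u t + δ * v t)
          ≈⟨ solve 6 (λ α β γ δ u v → :- γ :* (α :* u :+ β :* v) :+ α :* (γ :* u :+ δ :* v)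
                        := (α :* δ :- β :* γ) :* v) refl α β γ δ (u t) (v t) ⟩
        D * v t                                             ≈⟨ D*≈0 ⟩
        0#                                                  ∎)
      β≈0 : β ≈ 0#
      β≈0 = -≈0⇒≈0 (proj₂ (x,y-indep δ (- β) λ t → begin
        δ * x t + - β * y t                                 ≈⟨ +-cong (*-congˡ (x≈ t)) (*-congˡ (y≈ t)) ⟩
        δ * (α * u t + β * v t) + - β * (γ * u t + δ * v t)
          ≈⟨ solve 6 (λ α β γ δ u v → δ :* (α :* u :+ β :* v) :+ :- β :* (γ :* u :+ δ :* v)
                        := (α :* δ :- β :* γ) :* u) refl α β γ δ (u t) (v t) ⟩
        D * u t                                             ≈⟨ D*≈0 ⟩
        0#                                                  ∎))
      x≈0 : ((1# · x) ⊕ (0# · y)) ≈V 0V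
      x≈0 t = begin
        1# * x t + 0# * y t              ≈⟨ +-cong (*-identityˡ (x t)) (zeroˡ (y t)) ⟩
        x t + 0#                         ≈⟨ +-identityʳ (x t) ⟩
        x t                              ≈⟨ x≈ t ⟩
        α * u t + β * v t                ≈⟨ +-cong (*-congʳ α≈0) (*-congʳ β≈0) ⟩
        0# * u t + 0# * v t              ≈⟨ +-cong (zeroˡ (u t)) (zeroˡ (v t)) ⟩
        0# + 0#                          ≈⟨ +-identityʳ 0# ⟩
        0#                               ∎

    D⁻¹ = inv D D≉0
    D⁻¹D≈1 : D⁻¹ * D ≈ 1#
    D⁻¹D≈1 = inv-*ˡ D D≉0

  sameLine-setoid : Setoid (c ⊔ ℓ) (c ⊔ ℓ)
  sameLine-setoid = record
    { Carrier = Line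
    ; _≈_ = SameLine
    ; isEquivalence = record
      { refl = (λ _ w∈ → w∈) , (λ _ w∈ → w∈)
      ; sym = λ (L⊆M , M⊆L) → M⊆L , L⊆M
      ; trans = λ (L⊆M , M⊆L) (M⊆N , N⊆M) →
                  (λ w w∈ → M⊆N w (L⊆M w w∈)) , (λ w w∈ → M⊆L w (N⊆M w w∈))
      }
    }

  sameLine-of-basis : ∀ {u v u′ v′} (u,v-indep : Independent u v) (u′,v′-indep : Independent u′ v′) →
                      Span u v u′ → Span u v v′ → SameLine ((u , v) , u,v-indep) ((u′ , v′) , u′,v′-indep)
  sameLine-of-basis _ u′,v′-indep u′∈ v′∈ =
    (λ w → span-⊆ u′,v′-indep u′∈ v′∈) ,
    (λ w (a , b , w≈) → span-resp (λ t → sym (w≈ t)) (span-lincomb u′∈ v′∈ a b))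

  inLine-resp : ∀ M {w w′} → w ≈V w′ → InLine M w → InLine M w′
  inLine-resp ((u , v) , _) = span-resp

  inLine-scale : ∀ M {w} → InLine M w → ∀ α → InLine M (α · w)
  inLine-scale ((u , v) , _) = span-scale

  independent-by-zeros : ∀ {x y} i j → x i ≈ 0# → ¬ y i ≈ 0# → ¬ x j ≈ 0# → Independent x y
  independent-by-zeros {x} {y} i j xi≈0 yi≉0 xj≉0 a b ax+by≈0 = a≈0 , b≈0
    where
    b≈0 : b ≈ 0#
    b≈0 = *≈0⇒≈0ˡ yi≉0 (begin
      b * y i               ≈⟨ +-identityˡ _ ⟨
      0# + b * y i          ≈⟨ +-congʳ (trans (*-congˡ xi≈0) (zeroʳ a)) ⟨
      a * x i + b * y i     ≈⟨ ax+by≈0 i ⟩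
      0#                    ∎)
    a≈0 : a ≈ 0#
    a≈0 = *≈0⇒≈0ˡ xj≉0 (begin
      a * x j               ≈⟨ +-identityʳ _ ⟨
      a * x j + 0#          ≈⟨ +-congˡ (trans (*-congʳ b≈0) (zeroˡ (y j))) ⟨
      a * x j + b * y j     ≈⟨ ax+by≈0 j ⟩
      0#                    ∎)

  simplexVector-scale : ∀ {x w a} → SimplexVector x → ¬ a ≈ 0# → w ≈V (a · x) → SimplexVector w
  simplexVector-scale {a = a} (i , xi≈0 , only-i) a≉0 w≈ax =
    i , trans (w≈ax i) (trans (*-congˡ xi≈0) (zeroʳ a)) ,
    λ j wj≈0 → only-i j (*≈0⇒≈0ʳ a≉0 (trans (sym (w≈ax j)) wj≈0))

module SimplexLines {c ℓ : Level} (K : Field c ℓ) (d : ℕ) (_≟_ : ∀ x y → Dec (Field._≈_ K x y)) where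
  open Field K hiding (zero)
  open FieldProperties K
  open Simplex K (ℕ.suc (ℕ.suc d))
  open Vectors K (ℕ.suc (ℕ.suc d))
  open import Relation.Binary.Reasoning.Setoid setoid

  other : Fin (ℕ.suc (ℕ.suc d)) → Fin (ℕ.suc (ℕ.suc d))
  other zero    = suc zero
  other (suc _) = zero

  other-≢ : ∀ k → ¬ other k ≡ k
  other-≢ zero    ()
  other-≢ (suc _) ()

  module _ {u v : V} (u,v-indep : Independent u v) (simplex : SimplexLine ((u , v) , u,v-indep)) where

    vanishingAt : Fin (ℕ.suc (ℕ.suc d)) → V
    vanishingAt k = (v k · u) ⊕ ((- u k) · v)

    vanishingAt∈ : ∀ k → Span u v (vanishingAt k)
    vanishingAt∈ k = v k , - u k , λ _ → refl

    vanishingAt-vanishes : ∀ k → vanishingAt k k ≈ 0#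
    vanishingAt-vanishes k = solve 2 (λ uk vk → vk :* uk :+ :- uk :* vk := con (+ 0)) refl (u k) (v k)

    -- Otherwise the nonzero vector vanishingAt (other k) of the line would vanish at both k and other k.
    coordinates-not-both-zero : ∀ k → u k ≈ 0# → v k ≈ 0# → ⊥
    coordinates-not-both-zero k uk≈0 vk≈0 = other-≢ k (≡.trans (only-zero k′ (vanishingAt-vanishes k′))
                                                            (≡.sym (only-zero k vanishes-at-k)))
      where
      k′ = other k
      u≉0 : NonZero u
      u≉0 u≈0 = 1≉0 (proj₁ (u,v-indep 1# 0# λ t →
        trans (+-cong (*-identityˡ (u t)) (zeroˡ (v t))) (trans (+-identityʳ (u t)) (u≈0 t))))
      uk′≉0 : ¬ u k′ ≈ 0#
      uk′≉0 uk′≈0 with simplex u span-left u≉0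
      ... | (_ , _ , only-zero) = other-≢ k (≡.trans (only-zero k′ uk′≈0) (≡.sym (only-zero k uk≈0)))
      p≉0 : NonZero (vanishingAt k′)
      p≉0 p≈0 = uk′≉0 (-≈0⇒≈0 (proj₂ (u,v-indep (v k′) (- u k′) p≈0)))
      only-zero = proj₂ (proj₂ (simplex (vanishingAt k′) (vanishingAt∈ k′) p≉0))
      vanishes-at-k : vanishingAt k′ k ≈ 0#
      vanishes-at-k = trans (+-cong (trans (*-congˡ uk≈0) (zeroʳ _)) (trans (*-congˡ vk≈0) (zeroʳ _)))
                            (+-identityʳ 0#)

    vanishingAt-nonZero : ∀ k → NonZero (vanishingAt k)
    vanishingAt-nonZero k p≈0 = let (vk≈0 , -uk≈0) = u,v-indep (v k) (- u k) p≈0 in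
      coordinates-not-both-zero k (-≈0⇒≈0 -uk≈0) vk≈0

    vanishingAt-only-at : ∀ k j → vanishingAt k j ≈ 0# → j ≡ k
    vanishingAt-only-at k j pj≈0 with simplex (vanishingAt k) (vanishingAt∈ k) (vanishingAt-nonZero k)
    ... | (_ , _ , only-zero) = ≡.trans (only-zero j pj≈0) (≡.sym (only-zero k (vanishingAt-vanishes k)))

    multiple-of-vanishingAt : ∀ {w} k → Span u v w → w k ≈ 0# → ∃[ γ ] (w ≈V (γ · vanishingAt k))
    multiple-of-vanishingAt {w} k (a , b , w≈) wk≈0 with v k ≟ 0#
    ... | no vk≉0 = a * inv (v k) vk≉0 , λ t → begin
      w t                                       ≈⟨ w≈ t ⟩
      a * u t + b * v t                         ≈⟨ +-cong (*-congʳ (*-identityʳ a)) (*-congʳ (*-identityʳ b)) ⟨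
      a * 1# * u t + b * 1# * v t               ≈⟨ +-cong (*-congʳ (*-congˡ (inv-*ˡ (v k) vk≉0)))
                                                          (*-congʳ (*-congˡ (inv-*ʳ (v k) vk≉0))) ⟨
      a * (vk⁻¹ * v k) * u t + b * (v k * vk⁻¹) * v t
                                                ≈⟨ +-congˡ (*-congʳ (trans (sym (*-assoc b (v k) vk⁻¹))
                                                                           (*-congʳ b*vk≈-a*uk))) ⟩
      a * (vk⁻¹ * v k) * u t + - (a * u k) * vk⁻¹ * v t
        ≈⟨ solve 6 (λ a i uk vk ut vt → a :* (i :* vk) :* ut :+ :- (a :* uk) :* i :* vt
                      := a :* i :* (vk :* ut :+ :- uk :* vt)) refl a vk⁻¹ (u k) (v k) (u t) (v t) ⟩
      a * vk⁻¹ * vanishingAt k t                ∎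
      where
      vk⁻¹ = inv (v k) vk≉0
      b*vk≈-a*uk : b * v k ≈ - (a * u k)
      b*vk≈-a*uk = x-y≈0⇒x≈y (trans (solve 2 (λ x y → y :- (:- x) := x :+ y) refl (a * u k) (b * v k))
                                    (trans (sym (w≈ k)) wk≈0))
    ... | yes vk≈0 = - (b * inv (u k) uk≉0) , λ t → begin
      w t                                       ≈⟨ w≈ t ⟩
      a * u t + b * v t                         ≈⟨ +-cong (*-congʳ a≈0) (*-congʳ (sym (*-identityʳ b))) ⟩
      0# * u t + b * 1# * v t                   ≈⟨ +-cong (*-congʳ (trans (*-congˡ vk≈0) (zeroʳ _)))
                                                          (*-congʳ (*-congˡ (inv-*ˡ (u k) uk≉0))) ⟨
      - (b * uk⁻¹) * v k * u t + b * (uk⁻¹ * u k) * v t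
        ≈⟨ solve 6 (λ b i uk vk ut vt → :- (b :* i) :* vk :* ut :+ b :* (i :* uk) :* vt
                      := :- (b :* i) :* (vk :* ut :+ :- uk :* vt)) refl b uk⁻¹ (u k) (v k) (u t) (v t) ⟩
      - (b * uk⁻¹) * vanishingAt k t            ∎
      where
      uk≉0 : ¬ u k ≈ 0#
      uk≉0 uk≈0 = coordinates-not-both-zero k uk≈0 vk≈0
      uk⁻¹ = inv (u k) uk≉0
      a≈0 : a ≈ 0#
      a≈0 = *≈0⇒≈0ˡ uk≉0 (begin
        a * u k                 ≈⟨ +-identityʳ _ ⟨
        a * u k + 0#            ≈⟨ +-congˡ (trans (*-congˡ vk≈0) (zeroʳ b)) ⟨
        a * u k + b * v k       ≈⟨ w≈ k ⟨
        w k                     ≈⟨ wk≈0 ⟩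
        0#                      ∎)

    span-vanishingAt-⊆ : ∀ {z} k → Span u v z → ¬ z k ≈ 0# → ∀ {w} → Span u v w → Span (vanishingAt k) z w
    span-vanishingAt-⊆ k z∈ zk≉0 = span-⊆
      (independent-by-zeros k (other k) (vanishingAt-vanishes k) zk≉0
         (λ p≈0 → other-≢ k (vanishingAt-only-at k (other k) p≈0)))
      (vanishingAt∈ k) z∈

module LinesThroughPoint {c ℓ : Level} (K : Field c ℓ) (m : ℕ) (_≟_ : ∀ x y → Dec (Field._≈_ K x y))
  (x : Simplex.V K (ℕ.suc (ℕ.suc m))) (π : Permutation′ (ℕ.suc (ℕ.suc m)))
  (x-zero : Field._≈_ K (x (π ⟨$⟩ʳ zero)) (Field.0# K))
  (x-only-zero : ∀ j → Field._≈_ K (x j) (Field.0# K) → j ≡ π ⟨$⟩ʳ zero) where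

  open Field K hiding (zero)
  open FieldProperties K
  open Simplex K (ℕ.suc (ℕ.suc m))
  open Vectors K (ℕ.suc (ℕ.suc m))
  open import Relation.Binary.Reasoning.Setoid setoid

  ι : Fin (ℕ.suc (ℕ.suc m)) → Fin (ℕ.suc (ℕ.suc m))
  ι a = π ⟨$⟩ʳ a

  ι-injective : ∀ {a b} → ι a ≡ ι b → a ≡ b
  ι-injective ιa≡ιb = ≡.trans (≡.sym (inverseˡ π)) (≡.trans (≡.cong (π ⟨$⟩ˡ_) ιa≡ιb) (inverseˡ π))

  by-ι : ∀ {p} (P : Fin (ℕ.suc (ℕ.suc m)) → Set p) → (∀ a → P (ι a)) → ∀ j → P j
  by-ι P P∘ι j = ≡.subst P (inverseʳ π) (P∘ι (π ⟨$⟩ˡ j))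

  x-simplex : SimplexVector x
  x-simplex = ι zero , x-zero , x-only-zero

  x-nonzero : ∀ a → ¬ x (ι (suc a)) ≈ 0#
  x-nonzero a xι≈0 with ι-injective (x-only-zero _ xι≈0)
  ... | ()

  directionCoordinate : (Fin m → Carrier) → Fin (ℕ.suc (ℕ.suc m)) → Carrier
  directionCoordinate g zero          = 1#
  directionCoordinate g (suc zero)    = 0#
  directionCoordinate g (suc (suc k)) = g k * x (ι (suc (suc k)))

  direction : (Fin m → Carrier) → V
  direction g j = directionCoordinate g (π ⟨$⟩ˡ j)

  direction-at : ∀ g a → direction g (ι a) ≈ directionCoordinate g a
  direction-at g a = reflexive (≡.cong (directionCoordinate g) (inverseˡ π))

  independent : ∀ g → Independent x (direction g)
  independent g = independent-by-zeros (ι zero) (ι (suc zero)) x-zero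
    (λ d≈0 → 1≉0 (trans (sym (direction-at g zero)) d≈0)) (x-nonzero zero)

  lineThrough : (Fin m → Carrier) → Line
  lineThrough g = (x , direction g) , independent g

  lineThrough-∋ : ∀ g → PointInLine x (lineThrough g)
  lineThrough-∋ g w (a , w≈ax) = a , 0# , λ t → trans (w≈ax t) (sym (trans (+-congˡ (zeroˡ _)) (+-identityʳ _)))

  module _ (g : Fin m → Carrier) (a b : Carrier) where

    lincomb-at₀ : ((a · x) ⊕ (b · direction g)) (ι zero) ≈ b
    lincomb-at₀ = begin
      a * x (ι zero) + b * direction g (ι zero)   ≈⟨ +-cong (*-congˡ x-zero) (*-congˡ (direction-at g zero)) ⟩
      a * 0# + b * 1#                             ≈⟨ +-cong (zeroʳ a) (*-identityʳ b) ⟩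
      0# + b                                      ≈⟨ +-identityˡ b ⟩
      b                                           ∎

    lincomb-at₁ : ((a · x) ⊕ (b · direction g)) (ι (suc zero)) ≈ a * x (ι (suc zero))
    lincomb-at₁ = begin
      a * x (ι (suc zero)) + b * direction g (ι (suc zero))   ≈⟨ +-congˡ (*-congˡ (direction-at g (suc zero))) ⟩
      a * x (ι (suc zero)) + b * 0#                           ≈⟨ +-congˡ (zeroʳ b) ⟩
      a * x (ι (suc zero)) + 0#                               ≈⟨ +-identityʳ _ ⟩
      a * x (ι (suc zero))                                    ∎

    lincomb-at₂ : ∀ k → ((a · x) ⊕ (b · direction g)) (ι (suc (suc k))) ≈ (a + b * g k) * x (ι (suc (suc k)))
    lincomb-at₂ k = begin
      a * x (ι (suc (suc k))) + b * direction g (ι (suc (suc k)))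
                                            ≈⟨ +-congˡ (*-congˡ (direction-at g (suc (suc k)))) ⟩
      a * x (ι (suc (suc k))) + b * (g k * x (ι (suc (suc k))))
                                            ≈⟨ solve 4 (λ a b gk xk → a :* xk :+ b :* (gk :* xk) := (a :+ b :* gk) :* xk)
                                                 refl a b (g k) (x (ι (suc (suc k)))) ⟩
      (a + b * g k) * x (ι (suc (suc k)))   ∎

  shifted : (Fin m → Carrier) → Carrier → V
  shifted g s = ((- s) · x) ⊕ (1# · direction g)

  shifted-nonZero : ∀ g s → NonZero (shifted g s)
  shifted-nonZero g s shifted≈0 = 1≉0 (trans (sym (lincomb-at₀ g (- s) 1#)) (shifted≈0 (ι zero)))

  shifted-zero-at₁ : ∀ g {s} → s ≈ 0# → shifted g s (ι (suc zero)) ≈ 0#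
  shifted-zero-at₁ g {s} s≈0 = begin
    shifted g s (ι (suc zero))   ≈⟨ lincomb-at₁ g (- s) 1# ⟩
    - s * x (ι (suc zero))       ≈⟨ *-congʳ (trans (-‿cong s≈0) -0#≈0#) ⟩
    0# * x (ι (suc zero))        ≈⟨ zeroˡ _ ⟩
    0#                           ∎

  shifted-zero-at₂ : ∀ g {s} k → g k ≈ s → shifted g s (ι (suc (suc k))) ≈ 0#
  shifted-zero-at₂ g {s} k gk≈s = begin
    shifted g s (ι (suc (suc k)))        ≈⟨ lincomb-at₂ g (- s) 1# k ⟩
    (- s + 1# * g k) * x (ι (suc (suc k))) ≈⟨ *-congʳ (+-congˡ (trans (*-identityˡ (g k)) gk≈s)) ⟩
    (- s + s) * x (ι (suc (suc k)))      ≈⟨ *-congʳ (-‿inverseˡ s) ⟩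
    0# * x (ι (suc (suc k)))             ≈⟨ zeroˡ _ ⟩
    0#                                   ∎

  shifted-zero : ∀ g s a → shifted g s (ι a) ≈ 0# →
                 (a ≡ suc zero × s ≈ 0#) ⊎ ∃[ k ] (a ≡ suc (suc k) × g k ≈ s)
  shifted-zero g s zero          z≈0 = ⊥-elim (1≉0 (trans (sym (lincomb-at₀ g (- s) 1#)) z≈0))
  shifted-zero g s (suc zero)    z≈0 =
    inj₁ (≡.refl , -≈0⇒≈0 (*≈0⇒≈0ˡ (x-nonzero zero) (trans (sym (lincomb-at₁ g (- s) 1#)) z≈0)))
  shifted-zero g s (suc (suc k)) z≈0 = inj₂ (k , ≡.refl , sym (x-y≈0⇒x≈y (begin
    s - g k            ≈⟨ solve 2 (λ s gk → s :- gk := :- (:- s :+ gk)) refl s (g k) ⟩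
    - (- s + g k)      ≈⟨ -‿cong (+-congˡ (*-identityˡ (g k))) ⟨
    - (- s + 1# * g k) ≈⟨ -‿cong (*≈0⇒≈0ˡ (x-nonzero (suc k)) (trans (sym (lincomb-at₂ g (- s) 1# k)) z≈0)) ⟩
    - 0#               ≈⟨ -0#≈0# ⟩
    0#                 ∎)))

  NonZeroScalar : Carrier → Set ℓ
  NonZeroScalar a = ¬ a ≈ 0#

  shifted-simplex : ∀ {g} → Enumerates setoid NonZeroScalar g → ∀ s → SimplexVector (shifted g s)
  shifted-simplex {g} e s with s ≟ 0#
  ... | yes s≈0 = ι (suc zero) , shifted-zero-at₁ g s≈0 ,
                  by-ι (λ j → shifted g s j ≈ 0# → j ≡ ι (suc zero)) only-zero
    where
    only-zero : ∀ a → shifted g s (ι a) ≈ 0# → ι a ≡ ι (suc zero)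
    only-zero a z≈0 with shifted-zero g s a z≈0
    ... | inj₁ (a≡1 , _)      = ≡.cong ι a≡1
    ... | inj₂ (k , _ , gk≈s) = ⊥-elim (Enumerates.into e k (trans gk≈s s≈0))
  ... | no s≉0 = ι (suc (suc k₀)) , shifted-zero-at₂ g k₀ gk₀≈s ,
                 by-ι (λ j → shifted g s j ≈ 0# → j ≡ ι (suc (suc k₀))) only-zero
    where
    k₀ = proj₁ (Enumerates.onto e s≉0)
    gk₀≈s = proj₂ (Enumerates.onto e s≉0)
    only-zero : ∀ a → shifted g s (ι a) ≈ 0# → ι a ≡ ι (suc (suc k₀))
    only-zero a z≈0 with shifted-zero g s a z≈0
    ... | inj₁ (_ , s≈0)           = ⊥-elim (s≉0 s≈0)
    ... | inj₂ (k , ≡.refl , gk≈s) =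
      ≡.cong (λ k → ι (suc (suc k))) (Enumerates.injective e (trans gk≈s (sym gk₀≈s)))

  lineThrough-simplex : ∀ {g} → Enumerates setoid NonZeroScalar g → SimplexLine (lineThrough g)
  lineThrough-simplex {g} e w (a , b , w≈) w≉0 with b ≟ 0#
  ... | yes b≈0 = simplexVector-scale x-simplex a≉0 w≈a·x
    where
    w≈a·x : w ≈V (a · x)
    w≈a·x t = trans (w≈ t) (trans (+-congˡ (trans (*-congʳ b≈0) (zeroˡ _))) (+-identityʳ _))
    a≉0 : ¬ a ≈ 0#
    a≉0 a≈0 = w≉0 λ t → trans (w≈a·x t) (trans (*-congʳ a≈0) (zeroˡ (x t)))
  ... | no b≉0 = simplexVector-scale (shifted-simplex e s) b≉0 λ t → begin
    w t                                       ≈⟨ w≈ t ⟩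
    a * x t + b * direction g t               ≈⟨ +-congʳ (*-congʳ (*-identityˡ a)) ⟨
    1# * a * x t + b * direction g t          ≈⟨ +-congʳ (*-congʳ (*-congʳ (inv-*ʳ b b≉0))) ⟨
    b * b⁻¹ * a * x t + b * direction g t
      ≈⟨ solve 5 (λ b i a X Y → b :* i :* a :* X :+ b :* Y := b :* (:- (:- (i :* a)) :* X :+ Y))
               refl b b⁻¹ a (x t) (direction g t) ⟩
    b * (- s * x t + direction g t)           ≈⟨ *-congˡ (+-congˡ (*-identityˡ _)) ⟨
    b * shifted g s t                         ∎
    where
    b⁻¹ = inv b b≉0
    s = - (b⁻¹ * a)

  directionCoordinate-cong : ∀ {g g′} → Pointwise _≈_ g g′ →
                             ∀ a → directionCoordinate g a ≈ directionCoordinate g′ a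
  directionCoordinate-cong g≈g′ zero          = refl
  directionCoordinate-cong g≈g′ (suc zero)    = refl
  directionCoordinate-cong g≈g′ (suc (suc k)) = *-congʳ (g≈g′ k)

  lineThrough-cong : ∀ {g g′} → Pointwise _≈_ g g′ → SameLine (lineThrough g) (lineThrough g′)
  lineThrough-cong {g} {g′} g≈g′ = sameLine-of-basis (independent g) (independent g′) span-left
    (span-resp (λ j → directionCoordinate-cong g≈g′ (π ⟨$⟩ˡ j)) span-right)

  lineThrough-injective : ∀ {g g′} → SameLine (lineThrough g) (lineThrough g′) → Pointwise _≈_ g g′
  lineThrough-injective {g} {g′} (L⊆L′ , _) = compare (L⊆L′ (direction g) span-right)
    where
    compare : Span x (direction g′) (direction g) → Pointwise _≈_ g g′
    compare (α , β , y≈) k = *-cancelʳ (x-nonzero (suc k)) (begin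
      g k * x (ι (suc (suc k)))            ≈⟨ direction-at g (suc (suc k)) ⟨
      direction g (ι (suc (suc k)))        ≈⟨ y≈ (ι (suc (suc k))) ⟩
      _                                    ≈⟨ lincomb-at₂ g′ α β k ⟩
      (α + β * g′ k) * x (ι (suc (suc k))) ≈⟨ *-congʳ (+-cong α≈0 (trans (*-congʳ β≈1) (*-identityˡ (g′ k)))) ⟩
      (0# + g′ k) * x (ι (suc (suc k)))    ≈⟨ *-congʳ (+-identityˡ (g′ k)) ⟩
      g′ k * x (ι (suc (suc k)))           ∎)
      where
      α≈0 : α ≈ 0#
      α≈0 = *≈0⇒≈0ˡ (x-nonzero zero) (begin
        α * x (ι (suc zero))         ≈⟨ lincomb-at₁ g′ α β ⟨
        _                            ≈⟨ y≈ (ι (suc zero)) ⟨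
        direction g (ι (suc zero))   ≈⟨ direction-at g (suc zero) ⟩
        0#                           ∎)
      β≈1 : β ≈ 1#
      β≈1 = trans (sym (lincomb-at₀ g′ α β)) (trans (sym (y≈ (ι zero))) (direction-at g zero))

  lineThrough-surjective : ∀ L → SimplexLine L → PointInLine x L →
                           ∃[ g ] (Enumerates setoid NonZeroScalar g × SameLine L (lineThrough g))
  lineThrough-surjective ((u , v) , u,v-indep) simplex x∈L =
    g , enumerates , sameLine-of-basis u,v-indep (independent g) x∈ direction∈
    where
    open SimplexLines K m _≟_ using (vanishingAt; vanishingAt∈; vanishingAt-vanishes; vanishingAt-only-at)
    p = vanishingAt u,v-indep simplex (ι (suc zero))
    p₀≉0 : ¬ p (ι zero) ≈ 0#
    p₀≉0 p₀≈0 with ι-injective (vanishingAt-only-at u,v-indep simplex (ι (suc zero)) (ι zero) p₀≈0)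
    ... | ()
    y = inv (p (ι zero)) p₀≉0 · p

    g : Fin m → Carrier
    g k = y (ι (suc (suc k))) * inv (x (ι (suc (suc k)))) (x-nonzero (suc k))

    direction≈y : direction g ≈V y
    direction≈y = by-ι (λ j → direction g j ≈ y j) λ
      { zero → trans (direction-at g zero) (sym (inv-*ˡ _ p₀≉0))
      ; (suc zero) → trans (direction-at g (suc zero))
          (sym (trans (*-congˡ (vanishingAt-vanishes u,v-indep simplex (ι (suc zero)))) (zeroʳ _)))
      ; (suc (suc k)) → begin
          direction g (ι (suc (suc k)))                    ≈⟨ direction-at g (suc (suc k)) ⟩
          y (ι (suc (suc k))) * inv _ _ * x (ι (suc (suc k))) ≈⟨ *-assoc _ _ _ ⟩
          y (ι (suc (suc k))) * (inv _ _ * x (ι (suc (suc k)))) ≈⟨ *-congˡ (inv-*ˡ _ (x-nonzero (suc k))) ⟩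
          y (ι (suc (suc k))) * 1#                         ≈⟨ *-identityʳ _ ⟩
          y (ι (suc (suc k)))                              ∎ }

    x∈ : Span u v x
    x∈ = x∈L x (1# , λ t → sym (*-identityˡ (x t)))

    direction∈ : Span u v (direction g)
    direction∈ = span-resp (λ t → sym (direction≈y t))
                           (span-scale (vanishingAt∈ u,v-indep simplex (ι (suc zero))) _)

    shifted-simplex-in-L : ∀ s → SimplexVector (shifted g s)
    shifted-simplex-in-L s = simplex (shifted g s) (span-lincomb x∈ direction∈ (- s) 1#) (shifted-nonZero g s)

    shifted-has-zero : ∀ s → ∃[ a ] (shifted g s (ι a) ≈ 0#)
    shifted-has-zero s = let (j , zj≈0 , _) = shifted-simplex-in-L s in
      π ⟨$⟩ˡ j , ≡.subst (λ j → shifted g s j ≈ 0#) (≡.sym (inverseʳ π)) zj≈0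

    shifted-zero-unique : ∀ s a a′ → shifted g s (ι a) ≈ 0# → shifted g s (ι a′) ≈ 0# → a ≡ a′
    shifted-zero-unique s _ _ za≈0 za′≈0 = let (_ , _ , only-zero) = shifted-simplex-in-L s in
      ι-injective (≡.trans (only-zero _ za≈0) (≡.sym (only-zero _ za′≈0)))

    enumerates : Enumerates setoid NonZeroScalar g
    enumerates = record
      { into = λ k gk≈0 → Fin.0≢1+n (Fin.suc-injective (shifted-zero-unique 0# (suc zero) (suc (suc k))
          (shifted-zero-at₁ g refl) (shifted-zero-at₂ g k gk≈0)))
      ; injective = λ {k} {k′} gk≈gk′ → Fin.suc-injective (Fin.suc-injective
          (shifted-zero-unique (g k′) (suc (suc k)) (suc (suc k′))
            (shifted-zero-at₂ g k gk≈gk′) (shifted-zero-at₂ g k′ refl)))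
      ; onto = λ {s} s≉0 → onto s≉0 (shifted-has-zero s)
      }
      where
      onto : ∀ {s} → ¬ s ≈ 0# → ∃[ a ] (shifted g s (ι a) ≈ 0#) → ∃[ k ] (g k ≈ s)
      onto {s} s≉0 (a , za≈0) = located (shifted-zero g s a za≈0)
        where
        located : (a ≡ suc zero × s ≈ 0#) ⊎ ∃[ k ] (a ≡ suc (suc k) × g k ≈ s) → ∃[ k ] (g k ≈ s)
        located (inj₁ (_ , s≈0))      = ⊥-elim (s≉0 s≈0)
        located (inj₂ (k , _ , gk≈s)) = k , gk≈s

  lines-through-count : Count Carrier NonZeroScalar _≈_ m →
                        Count Line (λ L → SimplexLine L × PointInLine x L) SameLine (m !)
  lines-through-count nonZero-count =
    count-map (Pointwise.setoid setoid m) sameLine-setoid lineThrough lineThrough-cong lineThrough-injective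
      (λ {g} e → lineThrough-simplex e , lineThrough-∋ g)
      (λ {L} (simplex , x∈L) → lineThrough-surjective L simplex x∈L)
      (count-enumerations setoid (λ a≈b a≉0 b≈0 → a≉0 (trans a≈b b≈0)) nonZero-count)

module AdjacentLines {c ℓ : Level} (K : Field c ℓ) (m : ℕ) (_≟_ : ∀ x y → Dec (Field._≈_ K x y))
  {u v : Simplex.V K (ℕ.suc (ℕ.suc m))} (u,v-indep : Simplex.Independent K (ℕ.suc (ℕ.suc m)) u v)
  (simplex : Simplex.SimplexLine K (ℕ.suc (ℕ.suc m)) ((u , v) , u,v-indep)) where

  open Field K hiding (zero)
  open FieldProperties K
  open Simplex K (ℕ.suc (ℕ.suc m))
  open Vectors K (ℕ.suc (ℕ.suc m))
  open SimplexLines K m _≟_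
  open import Relation.Binary.Reasoning.Setoid setoid

  L : Line
  L = (u , v) , u,v-indep

  p : Fin (ℕ.suc (ℕ.suc m)) → V
  p = vanishingAt u,v-indep simplex

  p-simplex : ∀ k → SimplexVector (p k)
  p-simplex k = k , vanishingAt-vanishes u,v-indep simplex k , vanishingAt-only-at u,v-indep simplex k

  p∈ : ∀ k → InLine L (p k)
  p∈ = vanishingAt∈ u,v-indep simplex

  inLine-of-pointInLine : ∀ {w} M → PointInLine w M → InLine M w
  inLine-of-pointInLine M w∈M = w∈M _ (1# , λ t → sym (*-identityˡ _))

  L∋p : ∀ k → PointInLine (p k) L
  L∋p k w (a , w≈) = span-resp (λ t → sym (w≈ t)) (span-scale (p∈ k) a)

  sameLine-if-∋ : ∀ k {z} M → InLine L z → ¬ z k ≈ 0# → InLine M (p k) → InLine M z → SameLine L M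
  sameLine-if-∋ k ((u′ , v′) , u′,v′-indep) z∈L zk≉0 pk∈M z∈M =
    swap (sameLine-of-basis u′,v′-indep u,v-indep (inM span-left) (inM span-right))
    where
    inM : ∀ {w} → InLine L w → InLine ((u′ , v′) , u′,v′-indep) w
    inM w∈L = let (a , b , w≈) = span-vanishingAt-⊆ u,v-indep simplex k z∈L zk≉0 w∈L in
      span-resp (λ t → sym (w≈ t)) (span-lincomb pk∈M z∈M a b)

  OtherLineThrough : Fin (ℕ.suc (ℕ.suc m)) → Line → Set (c ⊔ ℓ)
  OtherLineThrough k M = (SimplexLine M × PointInLine (p k) M) × ¬ SameLine L M

  LinesThroughCount : Set _
  LinesThroughCount = ∀ x → SimplexPoint x → Count Line (λ M → SimplexLine M × PointInLine x M) SameLine (m !)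

  through-count : LinesThroughCount → ∀ k → Count Line (OtherLineThrough k) SameLine (m ! ∸ 1)
  through-count lines-through-count k =
    count-remove sameLine-setoid (lines-through-count (p k) (p-simplex k)) {L} (simplex , L∋p k)

  through-disjoint : ∀ {k k′ M M′} → ¬ k ≡ k′ →
                     OtherLineThrough k M → OtherLineThrough k′ M′ → ¬ SameLine M M′
  through-disjoint {k} {k′} {M} {M′} k≢k′ ((_ , pk∈M) , L≉M) ((_ , pk′∈M′) , _) (_ , M′⊆M) =
    L≉M (sameLine-if-∋ k M (p∈ k′) (λ pk′k≈0 → k≢k′ (vanishingAt-only-at u,v-indep simplex k′ k pk′k≈0))
                       (inLine-of-pointInLine M pk∈M) (M′⊆M (p k′) (inLine-of-pointInLine M′ pk′∈M′)))

  through⇒adjacent : ∀ {k M} → OtherLineThrough k M → SimplexLine M × Adjacent L M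
  through⇒adjacent {k} {M} ((M-simplex , pk∈M) , L≉M) =
    M-simplex , L≉M , p k , vanishingAt-nonZero u,v-indep simplex k , p∈ k ,
    inLine-of-pointInLine M pk∈M , meet
    where
    meet : ∀ z → InLine L z → InLine M z → InPoint (p k) z
    meet z z∈L z∈M with z k ≟ 0#
    ... | yes zk≈0 = multiple-of-vanishingAt u,v-indep simplex k z∈L zk≈0
    ... | no zk≉0  = ⊥-elim (L≉M (sameLine-if-∋ k M z∈L zk≉0 (inLine-of-pointInLine M pk∈M) z∈M))

  adjacent⇒through : ∀ {M} → SimplexLine M × Adjacent L M → ∃[ k ] (⊤ × OtherLineThrough k M)
  adjacent⇒through {M} (M-simplex , L≉M , w , w≉0 , w∈L , w∈M , _) =
    let (k , wk≈0 , _) = simplex w w∈L w≉0 in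
    k , tt , (M-simplex , point∈M k (multiple-of-vanishingAt u,v-indep simplex k w∈L wk≈0)) , L≉M
    where
    point∈M : ∀ k → ∃[ γ ] (w ≈V (γ · p k)) → PointInLine (p k) M
    point∈M k (γ , w≈γp) z (a , z≈) = inLine-resp M (λ t → begin
        a * (γ⁻¹ * w t)           ≈⟨ *-congˡ (*-congˡ (w≈γp t)) ⟩
        a * (γ⁻¹ * (γ * p k t))   ≈⟨ *-congˡ (*-assoc _ _ _) ⟨
        a * (γ⁻¹ * γ * p k t)     ≈⟨ *-congˡ (*-congʳ (inv-*ˡ γ γ≉0)) ⟩
        a * (1# * p k t)          ≈⟨ *-congˡ (*-identityˡ _) ⟩
        a * p k t                 ≈⟨ z≈ t ⟨
        z t                       ∎)
      (inLine-scale M (inLine-scale M w∈M γ⁻¹) a)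
      where
      γ≉0 : ¬ γ ≈ 0#
      γ≉0 γ≈0 = w≉0 λ t → trans (w≈γp t) (trans (*-congʳ γ≈0) (zeroˡ _))
      γ⁻¹ = inv γ γ≉0

  adjacent-count : LinesThroughCount →
                   Count Line (λ M → SimplexLine M × Adjacent L M) SameLine (ℕ.suc (ℕ.suc m) ℕ.* (m ! ∸ 1))
  adjacent-count lines-through-count =
    count-cong sameLine-setoid (λ {M} (k , _ , through) → through⇒adjacent {k} {M} through)
                               (λ {M} → adjacent⇒through {M})
      (count-Σ (≡.setoid (Fin (ℕ.suc (ℕ.suc m)))) sameLine-setoid
               (λ {k} _ → through-count lines-through-count k) (λ { ≡.refl through → through })
               (λ {k} {k′} {M} {M′} → through-disjoint {k} {k′} {M} {M′})
               (count-allFin (ℕ.suc (ℕ.suc m))))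

module FiniteField {c ℓ : Level} (K : Field c ℓ) (m : ℕ) (size : HasSize K (ℕ.suc m)) where
  open Field K using (Carrier; _≈_; 0#; setoid; sym)
  open Simplex K (ℕ.suc (ℕ.suc m))

  _≟_ : ∀ x y → Dec (x ≈ y)
  x ≟ y = count⇒decidable setoid size tt tt

  nonZero-count : Count Carrier (λ a → ¬ a ≈ 0#) _≈_ m
  nonZero-count = count-cong setoid (λ (_ , 0≉a) a≈0 → 0≉a (sym a≈0)) (λ a≉0 → tt , λ 0≈a → a≉0 (sym 0≈a))
    (count-remove setoid size tt)

  lines-through-count : ∀ x → SimplexPoint x → Count Line (λ L → SimplexLine L × PointInLine x L) SameLine (m !)
  lines-through-count x (i , xi≈0 , only-i) =
    LinesThroughPoint.lines-through-count K m _≟_ x (transpose zero i) xi≈0 only-i nonZero-count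

  adjacent-count : ∀ L → SimplexLine L →
                   Count Line (λ M → SimplexLine M × Adjacent L M) SameLine (ℕ.suc (ℕ.suc m) ℕ.* (m ! ∸ 1))
  adjacent-count ((u , v) , u,v-indep) simplex =
    AdjacentLines.adjacent-count K m _≟_ u,v-indep simplex lines-through-count

open import Data.Nat using (_+_; _*_)

proposition1 : ∀ {c ℓ : Level} (K : Field c ℓ) (q : ℕ) → 3 ≤ q → IsPrimePower q → HasSize K q →
    let open Simplex K (q + 1) in
      (∀ x → SimplexPoint x →
        Count Line (λ L → SimplexLine L × PointInLine x L) SameLine ((q ∸ 1) !))
    × (∀ L → SimplexLine L →
        Count Line (λ M → SimplexLine M × Adjacent L M) SameLine ((q + 1) * ((q ∸ 1) ! ∸ 1)))
proposition1 K (ℕ.suc m) (s≤s _) _ size rewrite ℕₚ.+-comm m 1 = lines-through-count , adjacent-count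
  where open FiniteField K m size
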